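{- Let $m>2$ be an integer, $n=3m$, and let $a,b$ be integers with $a\equiv 0\pmod 3$ and $b\equiv 0\pmod 3$. Then the $n$-tuple $(a,b,a,\,a,b,a,\,\ldots,\,a,b,a)$ (block $(a,b,a)$ repeated $m$ times) does not represent an $m$-axial $3m$-polygon.
   Context: Let $V_n=\{v_k=e^{2\pi i k/n}: k=0,\dots,n-1\}\subset\mathbb{C}$. An $n$-polygon is a closed polygonal path visiting every point of $V_n$ exactly once (a Hamiltonian cycle on $V_n$ drawn with straight segments). An $n$-tuple $(e_1,\dots,e_n)$ with entries in $\{1,\dots,n-1\}$ represents the path starting at $v_0$ and moving successively to $v_{s_1},\dots,v_{s_n}$, where $s_k=e_1+\dots+e_k$ (indices mod $n$); it represents an $n$-polygon iff $n\nmid s_k$ for $1\le k\le n-1$ and $n\mid s_n$. A symmetry axis of an $n$-polygon is a line through $0$ such that reflection in it maps the polygon onto itself. An $m$-axial $3m$-polygon is a $3m$-polygon with exactly $m$ symmetry axes. -}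

module Defs where

open import Data.Nat using (ℕ; zero; suc; _<_; _≤_)
open import Data.Nat.Divisibility using () renaming (_∣_ to _∣ℕ_)
open import Data.Integer as ℤ using (ℤ; +_)
open import Data.Integer.Divisibility using (_∣_)
open import Data.List using (List; []; _∷_; length; take; concat; replicate; lookup)
open import Data.Nat.ListAction using (sum)
open import Data.Fin using (Fin)
open import Data.Product using (Σ; ∃; _×_)
open import Data.Sum using (_⊎_)
open import Function.Bundles using (_⇔_)
open import Function.Definitions using (Injective)
open import Relation.Binary.PropositionalEquality using (_≡_)
open import Relation.Nullary using (¬_)

Tuple : Set
Tuple = List ℕ

psum : Tuple → ℕ → ℕ
psum e k = sum (take k e)

_≡[mod_]_ : ℤ → ℕ → ℤ → Set
x ≡[mod n ] y = (+ n) ∣ (x ℤ.- y)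

RepresentsPolygon : Tuple → Set
RepresentsPolygon e =
  (∀ (i : Fin (length e)) → 1 ≤ lookup e i × lookup e i < length e)
  × (∀ k → 1 ≤ k → k < length e → ¬ (length e ∣ℕ psum e k))
  × (length e ∣ℕ psum e (length e))

-- The (undirected) edge {v_x, v_y} of the polygon path of e, vertex indices
-- read modulo n: the k-th segment goes from v_{s_k} to v_{s_{k+1}}, 0 ≤ k < n.
Edge : Tuple → ℤ → ℤ → Set
Edge e x y = ∃ λ k → k < length e ×
  ( ((+ psum e k) ≡[mod length e ] x × (+ psum e (suc k)) ≡[mod length e ] y)
  ⊎ ((+ psum e k) ≡[mod length e ] y × (+ psum e (suc k)) ≡[mod length e ] x))

-- The reflections of the plane through a line through 0 that preserve V_n are
-- exactly v_x ↦ v_{c-x} for c = 0,…,n-1 (pairwise distinct lines).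
Axis : Tuple → ℕ → Set
Axis e c = c < length e ×
  (∀ x y → Edge e x y → Edge e ((+ c) ℤ.- x) ((+ c) ℤ.- y))

HasExactlyAxes : Tuple → ℕ → Set
HasExactlyAxes e m = Σ (Fin m → ℕ) λ f → Injective _≡_ _≡_ f ×
  (∀ c → Axis e c ⇔ (∃ λ i → f i ≡ c))

RepresentsAxialPolygon : ℕ → Tuple → Set
RepresentsAxialPolygon m e =
  length e ≡ 3 Data.Nat.* m × RepresentsPolygon e × HasExactlyAxes e m

aba : ℕ → ℕ → ℕ → Tuple
aba m a b = concat (replicate m (a ∷ b ∷ a ∷ []))

-- Write a = 3a' and b = 3b', and put d = 2a' + b'. The prefix sums of the tuple at
-- positions 3j and 3j + 1 are 3jd and 3(jd + a'). If m divides no jd + a' with j < m,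
-- these m numbers have at most m - 1 nonzero residues mod m, so two coincide and m
-- divides td for some 0 < t < m. Either way a proper prefix sum is divisible by 3m:
-- the path returns to v_0 early, so the tuple is not even a polygon.
module Submission where

open import Defs
open import Data.Nat using (ℕ; suc; _+_; _*_; _∸_; _<_; _≤_; z≤n; s≤s; NonZero)
open import Data.Nat.Properties
open import Data.Nat.Divisibility using (_∣_; divides; *-monoˡ-∣; m%n≡0⇒n∣m)
open import Data.Nat.DivMod using (_%_; _/_; _mod_; m≡m%n+[m/n]*n; m%n<n)
open import Data.Nat.Tactic.RingSolver using (solve-∀)
open import Data.List using (length)
open import Data.Fin using (Fin; toℕ; punchOut) renaming (zero to fzero)
open import Data.Fin.Properties using (pigeonhole; punchOut-injective; toℕ-fromℕ<; toℕ<n)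
open import Data.Product using (∃; _×_; _,_)
open import Relation.Binary.PropositionalEquality
open import Relation.Nullary using (¬_)

[m+o]%n≡m%n⇒n∣o : ∀ m o n .{{_ : NonZero n}} → (m + o) % n ≡ m % n → n ∣ o
[m+o]%n≡m%n⇒n∣o m o n eq = divides (q′ ∸ q) (begin
  o                              ≡⟨ m+n∸m≡n m o ⟨
  (m + o) ∸ m                    ≡⟨ cong₂ _∸_ (m≡m%n+[m/n]*n (m + o) n) (m≡m%n+[m/n]*n m n) ⟩
  (r + q′ * n) ∸ (m % n + q * n) ≡⟨ cong (λ r′ → (r + q′ * n) ∸ (r′ + q * n)) eq ⟨
  (r + q′ * n) ∸ (r + q * n)     ≡⟨ [m+n]∸[m+o]≡n∸o r (q′ * n) (q * n) ⟩
  q′ * n ∸ q * n                 ≡⟨ *-distribʳ-∸ n q′ q ⟨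
  (q′ ∸ q) * n                   ∎)
  where
  open ≡-Reasoning
  r = (m + o) % n
  q′ = (m + o) / n
  q = m / n

[i*d+c]%n≡[j*d+c]%n⇒n∣[j∸i]*d : ∀ {i j} d c n .{{_ : NonZero n}} → i ≤ j →
  (i * d + c) % n ≡ (j * d + c) % n → n ∣ (j ∸ i) * d
[i*d+c]%n≡[j*d+c]%n⇒n∣[j∸i]*d {i} {j} d c n i≤j eq =
  [m+o]%n≡m%n⇒n∣o (i * d + c) ((j ∸ i) * d) n (begin
    (i * d + c + (j ∸ i) * d) % n ≡⟨ cong (_% n) (split i (j ∸ i) d c) ⟨
    ((i + (j ∸ i)) * d + c) % n   ≡⟨ cong (λ k → (k * d + c) % n) (m+[n∸m]≡n i≤j) ⟩
    (j * d + c) % n               ≡⟨ eq ⟨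
    (i * d + c) % n               ∎)
  where
  open ≡-Reasoning
  split : ∀ i t d c → (i + t) * d + c ≡ i * d + c + t * d
  split = solve-∀

module _ (n d c : ℕ) (∤j*d+c : ∀ j → j < suc n → ¬ suc n ∣ j * d + c) where
  private
    residue : Fin (suc n) → Fin (suc n)
    residue j = (toℕ j * d + c) mod suc n

    toℕ-residue : ∀ j → toℕ (residue j) ≡ (toℕ j * d + c) % suc n
    toℕ-residue j = toℕ-fromℕ< (m%n<n (toℕ j * d + c) (suc n))

    0≢residue : ∀ j → fzero ≢ residue j
    0≢residue j 0≡residue = ∤j*d+c (toℕ j) (toℕ<n j)
      (m%n≡0⇒n∣m _ (suc n) (trans (sym (toℕ-residue j)) (sym (cong toℕ 0≡residue))))

  ∤j*d+c⇒∣t*d : ∃ λ t → 0 < t × t < suc n × suc n ∣ t * d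
  ∤j*d+c⇒∣t*d with i , j , i<j , same ← pigeonhole (n<1+n n) (λ j → punchOut (0≢residue j)) =
    toℕ j ∸ toℕ i ,
    m<n⇒0<n∸m i<j ,
    ≤-<-trans (m∸n≤m (toℕ j) (toℕ i)) (toℕ<n j) ,
    [i*d+c]%n≡[j*d+c]%n⇒n∣[j∸i]*d d c (suc n) (<⇒≤ i<j) (begin
      (toℕ i * d + c) % suc n ≡⟨ toℕ-residue i ⟨
      toℕ (residue i)         ≡⟨ cong toℕ (punchOut-injective (0≢residue i) (0≢residue j) same) ⟩
      toℕ (residue j)         ≡⟨ toℕ-residue j ⟩
      (toℕ j * d + c) % suc n ∎)
    where open ≡-Reasoning

length-aba : ∀ m a b → length (aba m a b) ≡ m * 3
length-aba 0       a b = refl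
length-aba (suc m) a b = cong (3 +_) (length-aba m a b)

psum-aba-suc : ∀ m a b k → psum (aba (suc m) a b) (3 + k) ≡ a + (b + a) + psum (aba m a b) k
psum-aba-suc m a b k = reassoc a b (psum (aba m a b) k)
  where
  reassoc : ∀ a b s → a + (b + (a + s)) ≡ a + (b + a) + s
  reassoc = solve-∀

psum-aba-3j : ∀ {m j} a b → j ≤ m → psum (aba m a b) (j * 3) ≡ j * (a + (b + a))
psum-aba-3j {j = 0} a b _ = refl
psum-aba-3j {suc m} {suc j} a b (s≤s j≤m) =
  trans (psum-aba-suc m a b (j * 3)) (cong (a + (b + a) +_) (psum-aba-3j a b j≤m))

psum-aba-3j+1 : ∀ {m j} a b → j < m → psum (aba m a b) (suc (j * 3)) ≡ j * (a + (b + a)) + a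
psum-aba-3j+1 {suc m} {0} a b _ = +-identityʳ a
psum-aba-3j+1 {suc m} {suc j} a b (s≤s j<m) = begin
  psum (aba (suc m) a b) (3 + suc (j * 3)) ≡⟨ psum-aba-suc m a b (suc (j * 3)) ⟩
  d + psum (aba m a b) (suc (j * 3))       ≡⟨ cong (d +_) (psum-aba-3j+1 a b j<m) ⟩
  d + (j * d + a)                          ≡⟨ +-assoc d (j * d) a ⟨
  d + j * d + a                            ∎
  where
  open ≡-Reasoning
  d = a + (b + a)

aba-not-polygon : ∀ m a b → 3 ∣ a → 3 ∣ b → ¬ RepresentsPolygon (aba (suc m) a b)
aba-not-polygon m .(a * 3) .(b * 3) (divides a refl) (divides b refl) (_ , no-early-return , _) =
  let t , 0<t , t<n , n∣t*d = ∤j*d+c⇒∣t*d m d a n∤j*d+a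
  in  3n∤psum (t * 3) (≤-trans (s≤s z≤n) (*-monoˡ-≤ 3 0<t)) (*-monoˡ-< 3 t<n)
        (subst (n * 3 ∣_) (psum-3t t<n) (*-monoˡ-∣ 3 n∣t*d))
  where
  n = suc m
  d = a + (b + a)
  e = aba n (a * 3) (b * 3)

  3n∤psum : ∀ k → 1 ≤ k → k < n * 3 → ¬ n * 3 ∣ psum e k
  3n∤psum k 1≤k k<3n 3n∣s = no-early-return k 1≤k
    (subst (k <_) (sym (length-aba n _ _)) k<3n)
    (subst (_∣ psum e k) (sym (length-aba n _ _)) 3n∣s)

  psum-3t : ∀ {t} → t < n → t * d * 3 ≡ psum e (t * 3)
  psum-3t {t} t<n = trans (scale t a b) (sym (psum-aba-3j (a * 3) (b * 3) (<⇒≤ t<n)))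
    where
    scale : ∀ t a b → t * (a + (b + a)) * 3 ≡ t * (a * 3 + (b * 3 + a * 3))
    scale = solve-∀

  psum-3j+1 : ∀ {j} → j < n → (j * d + a) * 3 ≡ psum e (suc (j * 3))
  psum-3j+1 {j} j<n = trans (scale j a b) (sym (psum-aba-3j+1 (a * 3) (b * 3) j<n))
    where
    scale : ∀ j a b → (j * (a + (b + a)) + a) * 3 ≡ j * (a * 3 + (b * 3 + a * 3)) + a * 3
    scale = solve-∀

  n∤j*d+a : ∀ j → j < n → ¬ n ∣ j * d + a
  n∤j*d+a j j<n n∣x = 3n∤psum (suc (j * 3)) (s≤s z≤n)
    (≤-trans (n≤1+n _) (*-monoˡ-≤ 3 j<n))
    (subst (n * 3 ∣_) (psum-3j+1 j<n) (*-monoˡ-∣ 3 n∣x))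

lemma4 : ∀ (m a b : ℕ) → 2 < m → 3 ∣ a → 3 ∣ b →
           1 ≤ a → a < 3 * m → 1 ≤ b → b < 3 * m →
           ¬ RepresentsAxialPolygon m (aba m a b)
lemma4 0       _ _ () _ _ _ _ _ _ _
lemma4 (suc m) a b _ 3∣a 3∣b _ _ _ _ (_ , polygon , _) = aba-not-polygon m a b 3∣a 3∣b polygon
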